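{- Let $G=(V,E)$ be a connected $d$-regular graph and $\chi:V\to\{0,1\}$ with $\sum_{v\in V}\chi(v)$ odd, and suppose $G$ is an $(s,\delta)$-edge expander. Then every set of clauses $\mathbb{C}$ over the edge variables with $\mu(\mathbb{C})\le s$ satisfies $|\mathbb{C}|\ge\delta\cdot\mu(\mathbb{C})$.
   Context: Associate a Boolean variable $x_e$ with each edge $e\in E$. For $v\in V$, $\mathrm{PARITY}_{v,\chi}$ is the canonical CNF encoding of $\sum_{e\ni v}x_e\equiv\chi(v)\pmod 2$ (one clause over the incident edge variables for each violating assignment, falsified exactly by it). For a term $T$, $\mu_T(T)=\min\{|V'| : V'\subseteq V,\ T\land\bigwedge_{v\in V'}\mathrm{PARITY}_{v,\chi}\text{ is unsatisfiable}\}$. For a set of clauses $\mathbb{C}$ (identified with their conjunction), $\mu(\mathbb{C})=\max\{\mu_T(T): T \text{ a term with } T\vDash\mathbb{C}\}$, and $\mu(\mathbb{C})=0$ when $\mathbb{C}$ is unsatisfiable. $G$ is an $(s,\delta)$-edge expander if every $U\subseteq V$ with $|U|\le s$ satisfies $|\partial U|\ge\delta|U|$, where $\partial U$ is the set of edges with exactly one endpoint in $U$. $|\mathbb{C}|$ is the number of clauses (the clause space of the configuration).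
   Formalization: The parameter δ of the $(s,\delta)$-edge expander is rational. -}

module Defs where

open import Data.Nat using (ℕ; zero; suc)
open import Data.Bool using (Bool; true; false; _xor_; if_then_else_; T)
open import Data.Fin using (Fin)
open import Data.Fin.Subset using (Subset; _∈_; ∣_∣)
open import Data.Vec using (lookup)
open import Data.Product using (Σ; ∃; _×_; _,_; proj₁; proj₂)
open import Data.Sum using (_⊎_)
open import Data.List using (List; length; filter; foldr; map; allFin)
open import Data.List.Relation.Unary.All using (All)
open import Data.List.Relation.Unary.Any using (Any)
open import Data.Integer using (+_)
open import Data.Rational using (ℚ; _/_)
open import Relation.Binary.PropositionalEquality using (_≡_; _≢_)
open import Relation.Nullary using (¬_; Dec; yes; no)
open import Data.Fin using (_≟_)

record Graph : Set where
  field
    n     : ℕ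
    m     : ℕ
    ends  : Fin m → Fin n × Fin n
    noLoop : ∀ e → proj₁ (ends e) ≢ proj₂ (ends e)
    simple : ∀ e f → (proj₁ (ends e) ≡ proj₁ (ends f) × proj₂ (ends e) ≡ proj₂ (ends f))
                   ⊎ (proj₁ (ends e) ≡ proj₂ (ends f) × proj₂ (ends e) ≡ proj₁ (ends f))
                   → e ≡ f

open Graph public

Vtx : Graph → Set
Vtx G = Fin (n G)

Edge : Graph → Set
Edge G = Fin (m G)

incident : (G : Graph) → Vtx G → Edge G → Bool
incident G v e with v ≟ proj₁ (ends G e) | v ≟ proj₂ (ends G e)
... | yes _ | _     = true
... | no _  | yes _ = true
... | no _  | no _  = false

count : ∀ {k} → (Fin k → Bool) → ℕ
count {k} p = length (filter (λ i → Data.Bool._≟_ (p i) true) (allFin k))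

degree : (G : Graph) → Vtx G → ℕ
degree G v = count (incident G v)

Regular : Graph → ℕ → Set
Regular G d = ∀ v → degree G v ≡ d

data Reachable (G : Graph) : Vtx G → Vtx G → Set where
  here  : ∀ {u} → Reachable G u u
  stepF : ∀ {u w} (e : Edge G) → proj₁ (ends G e) ≡ u → Reachable G (proj₂ (ends G e)) w → Reachable G u w
  stepB : ∀ {u w} (e : Edge G) → proj₂ (ends G e) ≡ u → Reachable G (proj₁ (ends G e)) w → Reachable G u w

Connected : Graph → Set
Connected G = ∀ u v → Reachable G u v

boundarySize : (G : Graph) → Subset (n G) → ℕ
boundarySize G U = count (λ e → lookup U (proj₁ (ends G e)) xor lookup U (proj₂ (ends G e)))

ℕ→ℚ : ℕ → ℚ
ℕ→ℚ k = + k / 1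

EdgeExpander : (G : Graph) → ℕ → ℚ → Set
EdgeExpander G s δ = ∀ (U : Subset (n G)) → ∣ U ∣ Data.Nat.≤ s →
  (δ Data.Rational.* ℕ→ℚ ∣ U ∣) Data.Rational.≤ ℕ→ℚ (boundarySize G U)

sumOdd : ∀ {k} → (Fin k → Bool) → Bool
sumOdd {k} χ = foldr _xor_ false (map χ (allFin k))

Assignment : ℕ → Set
Assignment m = Fin m → Bool

Literal : ℕ → Set
Literal m = Fin m × Bool

LitTrue : ∀ {m} → Assignment m → Literal m → Set
LitTrue α (i , b) = α i ≡ b

Clause : ℕ → Set
Clause m = List (Literal m)

Term : ℕ → Set
Term m = List (Literal m)

-- a set of clauses, identified with its conjunction; |C| = length C
Clauses : ℕ → Set
Clauses m = List (Clause m)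

SatClause : ∀ {m} → Assignment m → Clause m → Set
SatClause α C = Any (LitTrue α) C

SatTerm : ∀ {m} → Assignment m → Term m → Set
SatTerm α t = All (LitTrue α) t

SatClauses : ∀ {m} → Assignment m → Clauses m → Set
SatClauses α 𝐂 = All (SatClause α) 𝐂

Entails : ∀ {m} → Term m → Clauses m → Set
Entails {m} t 𝐂 = ∀ (α : Assignment m) → SatTerm α t → SatClauses α 𝐂

Satisfiable : ∀ {m} → Clauses m → Set
Satisfiable {m} 𝐂 = Σ (Assignment m) λ α → SatClauses α 𝐂

-- PARITY_{v,χ}: the canonical CNF encoding of ∑_{e∋v} x_e ≡ χ(v) mod 2.
-- An assignment satisfies it exactly when the parity of the incident
-- edge variables equals χ(v); we use this (its semantics) directly.

parityAt : (G : Graph) → Assignment (m G) → Vtx G → Bool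
parityAt G α v = foldr _xor_ false
  (map (λ e → if incident G v e then α e else false) (allFin (m G)))

SatParity : (G : Graph) → (Vtx G → Bool) → Assignment (m G) → Vtx G → Set
SatParity G χ α v = parityAt G α v ≡ χ v

UnsatWithParity : (G : Graph) → (Vtx G → Bool) → Term (m G) → Subset (n G) → Set
UnsatWithParity G χ t V' =
  ¬ (Σ (Assignment (m G)) λ α → SatTerm α t × (∀ v → v ∈ V' → SatParity G χ α v))

IsMuT : (G : Graph) → (Vtx G → Bool) → Term (m G) → ℕ → Set
IsMuT G χ t k =
  (Σ (Subset (n G)) λ V' → ∣ V' ∣ ≡ k × UnsatWithParity G χ t V')
  × (∀ V' → UnsatWithParity G χ t V' → k Data.Nat.≤ ∣ V' ∣)

IsMu : (G : Graph) → (Vtx G → Bool) → Clauses (m G) → ℕ → Set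
IsMu G χ 𝐂 k =
  (¬ Satisfiable 𝐂 → k ≡ 0)
  × (Satisfiable 𝐂 →
      (Σ (Term (m G)) λ t → Entails t 𝐂 × IsMuT G χ t k)
      × (∀ t j → Entails t 𝐂 → IsMuT G χ t j → j Data.Nat.≤ k))

module Submission where

-- Let t ⊨ 𝐂 be a term with μ_T(t) = μ. Keeping from t one literal of each clause it meets gives a
-- subterm T with |T| ≤ |𝐂| that still entails 𝐂 (a clause disjoint from a satisfiable entailing term
-- is a tautology), so μ_T(T) = μ by maximality of μ and monotonicity of μ_T. Since the total charge
-- is odd, PARITY at every vertex is unsatisfiable (handshake lemma over 𝔽₂), so there is a least V
-- with T ∧ PARITY_V unsatisfiable, and |V| = μ ≤ s. Every edge leaving V is a variable of T:
-- otherwise, flipping it in a model of T ∧ PARITY_{V∖u} (u its endpoint in V) would give a model of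
-- T ∧ PARITY_V. Hence δμ ≤ |∂V| ≤ |T| ≤ |𝐂|. The least
-- V exists only classically, so the argument runs in the double-negation monad; the goal is
-- decidable.

open import Algebra.Bundles using (CommutativeRing)
open import Data.Bool using (Bool; true; false; not; _∧_; _xor_; if_then_else_)
import Data.Bool as Bool
open import Data.Bool.Properties
  using (xor-∧-commutativeRing; xor-identityʳ; xor-same; xor-comm; ¬-not; ∧-distribʳ-xor; ∧-distribˡ-xor; ∧-comm)
open import Data.Fin using (Fin; zero; suc; _≟_)
open import Data.Fin.Subset using (Subset; ∣_∣; _-_; ⊤; ⊥) renaming (_∈_ to _∈ₛ_)
open import Data.Fin.Subset.Properties using (∈⊤; ∣⊥∣≡0; x∈p∧x≢y⇒x∈p-y; x∈p⇒∣p-x∣<∣p∣)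
open import Data.Integer as ℤ using ()
import Data.Integer.Properties as ℤ
open import Data.List using (List; []; _∷_; length; foldr; map; filter; tabulate; allFin)
open import Data.List.Properties using (map-tabulate; length-map)
open import Data.List.Membership.Propositional using (_∈_; find; lose)
open import Data.List.Membership.Propositional.Properties using (∈-map⁺)
import Data.List.Membership.DecPropositional as DecMembership
open import Data.List.Relation.Binary.Subset.Propositional using (_⊆_)
open import Data.List.Relation.Unary.All as All using ([]; _∷_)
open import Data.List.Relation.Unary.All.Properties using (anti-mono)
open import Data.List.Relation.Unary.Any as Any using (here; there; any?)
open import Data.Nat using (ℕ; zero; suc; _≤_; _<_; z≤n; s≤s)
open import Data.Nat.Coprimality using (1-coprimeTo) renaming (sym to coprime-sym)
open import Data.Nat.Properties
  using (n≤0⇒n≡0; ≤-antisym; ≤-refl; ≤-reflexive; ≤-trans; <-≤-trans; ≤-pred; ≮⇒≥; ≤⇒≯; m≤n⇒m≤1+n;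
         module ≤-Reasoning)
open import Data.Product using (Σ; ∃; _×_; _,_; proj₁; proj₂)
open import Data.Product.Properties using (≡-dec)
open import Data.Rational using (ℚ; mkℚ; *≤*) renaming (_≤_ to _≤ℚ_; _*_ to _*ℚ_)
import Data.Rational.Properties as ℚ
open import Data.Vec using (lookup)
open import Data.Vec.Properties using ([]=⇒lookup; lookup⇒[]=)
open import Effect.Monad using (RawMonad)
open import Function using (_∘_; id)
open import Level using (0ℓ)
open import Relation.Binary.PropositionalEquality
open import Relation.Nullary using (¬_; Dec; does; yes; no; contradiction)
open import Relation.Nullary.Decidable using (dec-true; dec-false; decidable-stable; ¬¬-excluded-middle)
open import Relation.Nullary.Negation using (¬¬-Monad)

open import Defs

open import Algebra.Properties.Semiring.Sum (CommutativeRing.semiring xor-∧-commutativeRing)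
  using (sum-syntax; ∑-comm; ∑-distrib-+; sum-replicate-zero; sum-cong-≗)

open RawMonad (¬¬-Monad {0ℓ})

foldr-xor-tabulate : ∀ {k} (f : Fin k → Bool) → foldr _xor_ false (tabulate f) ≡ ∑[ i < k ] f i
foldr-xor-tabulate {zero}  f = refl
foldr-xor-tabulate {suc k} f = cong (f zero xor_) (foldr-xor-tabulate (f ∘ suc))

foldr-xor-allFin : ∀ {k} (f : Fin k → Bool) → foldr _xor_ false (map f (allFin k)) ≡ ∑[ i < k ] f i
foldr-xor-allFin {k} f = trans (cong (foldr _xor_ false) (map-tabulate id f)) (foldr-xor-tabulate f)

∑-pick : ∀ {k} (f : Fin k → Bool) p → ∑[ i < k ] (does (i ≟ p) ∧ f i) ≡ f p
∑-pick {suc k} f zero    = trans (cong (f zero xor_) (sum-replicate-zero k)) (xor-identityʳ (f zero))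
∑-pick {suc k} f (suc p) = ∑-pick (f ∘ suc) p

flipAt : ∀ {k} → Assignment k → Fin k → Assignment k
flipAt α e i = α i xor does (i ≟ e)

flipAt-preserves-SatTerm : ∀ {k} {α : Assignment k} {e} (T : Term k) →
  ¬ e ∈ map proj₁ T → SatTerm α T → SatTerm (flipAt α e) T
flipAt-preserves-SatTerm {α = α} {e} T e∉T α⊨T = All.tabulate satisfied
  where
  satisfied : ∀ {l} → l ∈ T → LitTrue (flipAt α e) l
  satisfied {i , b} l∈T = begin
    α i xor does (i ≟ e)  ≡⟨ cong (α i xor_) (dec-false (i ≟ e) λ { refl → e∉T (∈-map⁺ proj₁ l∈T) }) ⟩
    α i xor false         ≡⟨ xor-identityʳ (α i) ⟩
    α i                   ≡⟨ All.lookup α⊨T l∈T ⟩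
    b                     ∎
    where open ≡-Reasoning

length-filter-tabulate : ∀ {A : Set} {k} (g : Fin k → A) (p : A → Bool) →
  length (filter (λ a → p a Bool.≟ true) (tabulate g)) ≡ count (p ∘ g)
length-filter-tabulate {k = zero}  g p = refl
length-filter-tabulate {k = suc k} g p with p (g zero)
... | true  = cong suc (trans (length-filter-tabulate (g ∘ suc) p) (sym (length-filter-tabulate suc (p ∘ g))))
... | false = trans (length-filter-tabulate (g ∘ suc) p) (sym (length-filter-tabulate suc (p ∘ g)))

count-suc : ∀ {k} (f : Fin (suc k) → Bool) →
  count f ≡ (if f zero then suc (count (f ∘ suc)) else count (f ∘ suc))
count-suc f with f zero
... | true  = cong suc (length-filter-tabulate suc f)
... | false = length-filter-tabulate suc f

count-≡0 : ∀ {k} (f : Fin k → Bool) → (∀ i → f i ≢ true) → count f ≡ 0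
count-≡0 {zero}  f none = refl
count-≡0 {suc k} f none with f zero in f₀ | count-suc f
... | true  | _  = contradiction f₀ (none zero)
... | false | eq = trans eq (count-≡0 (f ∘ suc) (none ∘ suc))

count-≤-1+count-without : ∀ {k} (f : Fin k → Bool) y →
  count f ≤ suc (count (λ i → not (does (i ≟ y)) ∧ f i))
count-≤-1+count-without f zero = begin
  count f
    ≡⟨ count-suc f ⟩
  (if f zero then suc (count (f ∘ suc)) else count (f ∘ suc))
    ≤⟨ if-suc-≤ (f zero) ⟩
  suc (count (f ∘ suc))
    ≡⟨ cong suc (count-suc (λ i → not (does (i ≟ zero)) ∧ f i)) ⟨
  suc (count (λ i → not (does (i ≟ zero)) ∧ f i)) ∎
  where
  open ≤-Reasoning
  if-suc-≤ : ∀ {c} b → (if b then suc c else c) ≤ suc c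
  if-suc-≤ true  = ≤-refl
  if-suc-≤ false = m≤n⇒m≤1+n ≤-refl
count-≤-1+count-without f (suc y) = begin
  count f
    ≡⟨ count-suc f ⟩
  (if f zero then suc (count (f ∘ suc)) else count (f ∘ suc))
    ≤⟨ if-suc-mono (f zero) (count-≤-1+count-without (f ∘ suc) y) ⟩
  suc (if f zero then suc (count f′) else count f′)
    ≡⟨ cong suc (count-suc (λ i → not (does (i ≟ suc y)) ∧ f i)) ⟨
  suc (count (λ i → not (does (i ≟ suc y)) ∧ f i)) ∎
  where
  open ≤-Reasoning
  f′ : Fin _ → Bool
  f′ i = not (does (i ≟ y)) ∧ f (suc i)
  if-suc-mono : ∀ {c d} b → c ≤ suc d → (if b then suc c else c) ≤ suc (if b then suc d else d)
  if-suc-mono true  c≤1+d = s≤s c≤1+d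
  if-suc-mono false c≤1+d = c≤1+d

count-≤-length : ∀ {k} (f : Fin k → Bool) ys → (∀ i → f i ≡ true → i ∈ ys) → count f ≤ length ys
count-≤-length f []       covered = ≤-reflexive (count-≡0 f λ i fi → contradiction (covered i fi) λ ())
count-≤-length f (y ∷ ys) covered =
  ≤-trans (count-≤-1+count-without f y) (s≤s (count-≤-length _ ys covered′))
  where
  covered′ : ∀ i → not (does (i ≟ y)) ∧ f i ≡ true → i ∈ ys
  covered′ i fi with i ≟ y
  ... | no i≢y with covered i fi
  ...   | here i≡y = contradiction i≡y i≢y
  ...   | there i∈ys = i∈ys

IsLeast : {A : Set} → (A → ℕ) → (A → Set) → A → Set
IsLeast size P a = P a × (∀ b → P b → size a ≤ size b)

least-exists : {A : Set} (size : A → ℕ) (P : A → Set) {a : A} → P a → ¬ ¬ ∃ (IsLeast size P)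
least-exists size P {a} Pa = below (suc (size a)) Pa ≤-refl
  where
  below : ∀ bound {a} → P a → size a < bound → ¬ ¬ ∃ (IsLeast size P)
  below (suc bound) {a} Pa a<bound = do
    no nothing-smaller ← ¬¬-excluded-middle {A = ∃ λ b → P b × size b < size a}
      where yes (b , Pb , b<a) → below bound Pb (<-≤-trans b<a (≤-pred a<bound))
    pure (a , Pa , λ b Pb → ≮⇒≥ λ b<a → nothing-smaller (b , Pb , b<a))

module _ {k : ℕ} where

  _∈ₗ?_ : (l : Literal k) (xs : List (Literal k)) → Dec (l ∈ xs)
  _∈ₗ?_ = DecMembership._∈?_ (≡-dec _≟_ Bool._≟_)

  complementary-clause-valid : ∀ {C : Clause k} {i b} → (i , b) ∈ C → (i , not b) ∈ C → ∀ α → SatClause α C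
  complementary-clause-valid {i = i} {b} pos neg α with α i Bool.≟ b
  ... | yes αi≡b = Any.map (λ { refl → αi≡b }) pos
  ... | no  αi≢b = Any.map (λ { refl → ¬-not αi≢b }) neg

  disjoint-entailed-clause-valid : ∀ {t : Term k} {C : Clause k} {α₀} → SatTerm α₀ t →
    (∀ α → SatTerm α t → SatClause α C) → (∀ {l} → l ∈ C → ¬ l ∈ t) → ∀ α → SatClause α C
  disjoint-entailed-clause-valid {t} {C} {α₀} α₀⊨t t⊨C disjoint =
    complementary-clause-valid (proj₁ (proj₂ complementary)) (proj₂ (proj₂ complementary))
    where
    -- β flips α₀ exactly where C contains α₀'s literal; it still satisfies t, so it satisfies C,
    -- and it can only do so at a variable on which C has both literals.
    β : Assignment k
    β i = if does ((i , α₀ i) ∈ₗ? C) then not (α₀ i) else α₀ i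

    β-off-C : ∀ {i} → ¬ (i , α₀ i) ∈ C → β i ≡ α₀ i
    β-off-C i∉C = cong (λ d → if d then not _ else _) (dec-false (_ ∈ₗ? C) i∉C)

    β⊨t : SatTerm β t
    β⊨t = All.tabulate λ {(i , b)} l∈t →
      let α₀i≡b = All.lookup α₀⊨t l∈t in
      trans (β-off-C λ i∈C → disjoint (subst (λ x → (i , x) ∈ C) α₀i≡b i∈C) l∈t) α₀i≡b

    complementary : Σ (Fin k) λ j → (j , α₀ j) ∈ C × (j , not (α₀ j)) ∈ C
    complementary with find (t⊨C β β⊨t)
    ... | (j , c) , jc∈C , βj≡c with (j , α₀ j) ∈ₗ? C
    ...   | yes j∈C = j , j∈C , subst (λ x → (j , x) ∈ C) (sym βj≡c) jc∈C
    ...   | no  j∉C = contradiction (subst (λ x → (j , x) ∈ C) (sym βj≡c) jc∈C) j∉C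

  module _ (t : Term k) where

    hittingSubterm : Clauses k → Term k
    hittingSubterm []      = []
    hittingSubterm (C ∷ 𝐂) with any? (_∈ₗ? t) C
    ... | yes C∩t = proj₁ (find C∩t) ∷ hittingSubterm 𝐂
    ... | no  _   = hittingSubterm 𝐂

    hittingSubterm-length : ∀ 𝐂 → length (hittingSubterm 𝐂) ≤ length 𝐂
    hittingSubterm-length []      = z≤n
    hittingSubterm-length (C ∷ 𝐂) with any? (_∈ₗ? t) C
    ... | yes _ = s≤s (hittingSubterm-length 𝐂)
    ... | no  _ = m≤n⇒m≤1+n (hittingSubterm-length 𝐂)

    hittingSubterm-⊆ : ∀ 𝐂 → hittingSubterm 𝐂 ⊆ t
    hittingSubterm-⊆ (C ∷ 𝐂) l∈T with any? (_∈ₗ? t) C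
    hittingSubterm-⊆ (C ∷ 𝐂) (here refl)  | yes C∩t = proj₂ (proj₂ (find C∩t))
    hittingSubterm-⊆ (C ∷ 𝐂) (there l∈T) | yes _   = hittingSubterm-⊆ 𝐂 l∈T
    hittingSubterm-⊆ (C ∷ 𝐂) l∈T         | no  _   = hittingSubterm-⊆ 𝐂 l∈T

    hittingSubterm-entails : ∀ {α₀} 𝐂 → SatTerm α₀ t → Entails t 𝐂 → Entails (hittingSubterm 𝐂) 𝐂
    hittingSubterm-entails []      _    _      _ _   = []
    hittingSubterm-entails (C ∷ 𝐂) α₀⊨t t⊨C∷𝐂 α α⊨T with any? (_∈ₗ? t) C
    ... | yes C∩t = Any.map (λ { refl → All.head α⊨T }) (proj₁ (proj₂ (find C∩t)))
                  ∷ hittingSubterm-entails 𝐂 α₀⊨t (λ β → All.tail ∘ t⊨C∷𝐂 β) α (All.tail α⊨T)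
    ... | no  C∌t = disjoint-entailed-clause-valid α₀⊨t (λ β → All.head ∘ t⊨C∷𝐂 β)
                      (λ l∈C l∈t → C∌t (lose l∈C l∈t)) α
                  ∷ hittingSubterm-entails 𝐂 α₀⊨t (λ β → All.tail ∘ t⊨C∷𝐂 β) α α⊨T

module _ (G : Graph) where

  private
    end₁ end₂ : Edge G → Vtx G
    end₁ e = proj₁ (ends G e)
    end₂ e = proj₂ (ends G e)

  incident-≡-xor : ∀ v e → incident G v e ≡ does (v ≟ end₁ e) xor does (v ≟ end₂ e)
  incident-≡-xor v e with v ≟ end₁ e | v ≟ end₂ e
  ... | yes refl | yes v≡end₂ = contradiction v≡end₂ (noLoop G e)
  ... | yes _    | no  _      = refl
  ... | no  _    | yes _      = refl
  ... | no  _    | no  _      = refl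

  ∑-incident : ∀ e x → ∑[ v < n G ] (incident G v e ∧ x) ≡ false
  ∑-incident e x = begin
    ∑[ v < n G ] (incident G v e ∧ x)
      ≡⟨ sum-cong-≗ (λ v → cong (_∧ x) (incident-≡-xor v e)) ⟩
    ∑[ v < n G ] ((does (v ≟ end₁ e) xor does (v ≟ end₂ e)) ∧ x)
      ≡⟨ sum-cong-≗ (λ v → ∧-distribʳ-xor x (does (v ≟ end₁ e)) _) ⟩
    ∑[ v < n G ] ((does (v ≟ end₁ e) ∧ x) xor (does (v ≟ end₂ e) ∧ x))
      ≡⟨ ∑-distrib-+ (λ v → does (v ≟ end₁ e) ∧ x) (λ v → does (v ≟ end₂ e) ∧ x) ⟩
    ∑[ v < n G ] (does (v ≟ end₁ e) ∧ x) xor ∑[ v < n G ] (does (v ≟ end₂ e) ∧ x)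
      ≡⟨ cong₂ _xor_ (∑-pick (λ _ → x) (end₁ e)) (∑-pick (λ _ → x) (end₂ e)) ⟩
    x xor x
      ≡⟨ xor-same x ⟩
    false ∎
    where open ≡-Reasoning

  parityAt-≡-∑ : ∀ α v → parityAt G α v ≡ ∑[ e < m G ] (incident G v e ∧ α e)
  parityAt-≡-∑ α v =
    trans (foldr-xor-allFin (λ e → if incident G v e then α e else false))
          (sum-cong-≗ λ e → if-false≡∧ (incident G v e) (α e))
    where
    if-false≡∧ : ∀ b a → (if b then a else false) ≡ b ∧ a
    if-false≡∧ true  a = refl
    if-false≡∧ false a = refl

  ∑-parityAt : ∀ α → ∑[ v < n G ] parityAt G α v ≡ false
  ∑-parityAt α = begin
    ∑[ v < n G ] parityAt G α v                          ≡⟨ sum-cong-≗ (parityAt-≡-∑ α) ⟩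
    ∑[ v < n G ] ∑[ e < m G ] (incident G v e ∧ α e)    ≡⟨ ∑-comm (λ v e → incident G v e ∧ α e) ⟩
    ∑[ e < m G ] ∑[ v < n G ] (incident G v e ∧ α e)    ≡⟨ sum-cong-≗ (λ e → ∑-incident e (α e)) ⟩
    ∑[ e < m G ] false                                   ≡⟨ sum-replicate-zero (m G) ⟩
    false                                                ∎
    where open ≡-Reasoning

  odd-charge-unsatisfiable : ∀ χ → sumOdd χ ≡ true → ∀ α → ¬ (∀ v → SatParity G χ α v)
  odd-charge-unsatisfiable χ odd α sat = contradiction true≡false λ ()
    where
    open ≡-Reasoning
    true≡false : true ≡ false
    true≡false = begin
      true                          ≡⟨ odd ⟨
      sumOdd χ                      ≡⟨ foldr-xor-allFin χ ⟩
      ∑[ v < n G ] χ v              ≡⟨ sum-cong-≗ sat ⟨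
      ∑[ v < n G ] parityAt G α v   ≡⟨ ∑-parityAt α ⟩
      false                         ∎

  parityAt-flipAt : ∀ α e v → parityAt G (flipAt α e) v ≡ parityAt G α v xor incident G v e
  parityAt-flipAt α e v = begin
    parityAt G (flipAt α e) v
      ≡⟨ parityAt-≡-∑ (flipAt α e) v ⟩
    ∑[ e′ < m G ] (incident G v e′ ∧ (α e′ xor does (e′ ≟ e)))
      ≡⟨ sum-cong-≗ (λ e′ → ∧-distribˡ-xor (incident G v e′) (α e′) _) ⟩
    ∑[ e′ < m G ] ((incident G v e′ ∧ α e′) xor (incident G v e′ ∧ does (e′ ≟ e)))
      ≡⟨ ∑-distrib-+ (λ e′ → incident G v e′ ∧ α e′) (λ e′ → incident G v e′ ∧ does (e′ ≟ e)) ⟩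
    ∑[ e′ < m G ] (incident G v e′ ∧ α e′) xor ∑[ e′ < m G ] (incident G v e′ ∧ does (e′ ≟ e))
      ≡⟨ cong₂ _xor_ (parityAt-≡-∑ α v) (sum-cong-≗ λ e′ → ∧-comm (does (e′ ≟ e)) (incident G v e′)) ⟨
    parityAt G α v xor ∑[ e′ < m G ] (does (e′ ≟ e) ∧ incident G v e′)
      ≡⟨ cong (parityAt G α v xor_) (∑-pick (incident G v) e) ⟩
    parityAt G α v xor incident G v e ∎
    where open ≡-Reasoning

  LeavesThrough : Subset (n G) → Edge G → Vtx G → Set
  LeavesThrough V e u =
    u ∈ₛ V × incident G u e ≡ true × (∀ v → v ∈ₛ V → v ≢ u → incident G v e ≡ false)

  leaves-through : ∀ {V e u w} → lookup V u ≡ true → lookup V w ≡ false → u ≢ w →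
    (∀ v → incident G v e ≡ does (v ≟ u) xor does (v ≟ w)) → LeavesThrough V e u
  leaves-through {V} {e} {u} {w} u∈V w∉V u≢w incident-uw =
      lookup⇒[]= u V u∈V
    , trans (incident-uw u) (cong₂ _xor_ (dec-true (u ≟ u) refl) (dec-false (u ≟ w) u≢w))
    , λ v v∈V v≢u → trans (incident-uw v) (cong₂ _xor_ (dec-false (v ≟ u) v≢u) (dec-false (v ≟ w) (v≢w v∈V)))
    where
    v≢w : ∀ {v} → v ∈ₛ V → v ≢ w
    v≢w v∈V refl = contradiction (trans (sym ([]=⇒lookup v∈V)) w∉V) λ ()

  crossing-edge-leaves : ∀ V e → lookup V (end₁ e) xor lookup V (end₂ e) ≡ true → ∃ (LeavesThrough V e)
  crossing-edge-leaves V e crossing with lookup V (end₁ e) in in₁ | lookup V (end₂ e) in in₂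
  ... | true  | false = end₁ e , leaves-through in₁ in₂ (noLoop G e) (λ v → incident-≡-xor v e)
  ... | false | true  = end₂ e , leaves-through in₂ in₁ (≢-sym (noLoop G e))
                                  (λ v → trans (incident-≡-xor v e) (xor-comm (does (v ≟ end₁ e)) _))

  module _ (χ : Vtx G → Bool) (T : Term (m G)) where

    repair-through : ∀ {V e u} → LeavesThrough V e u → ¬ e ∈ map proj₁ T →
      ∀ α → SatTerm α T → (∀ v → v ∈ₛ V - u → SatParity G χ α v) →
      Σ (Assignment (m G)) λ β → SatTerm β T × (∀ v → v ∈ₛ V → SatParity G χ β v)
    repair-through {V} {e} {u} (_ , incident-u , incident-others) e∉T α α⊨T α⊨V-u
      with parityAt G α u Bool.≟ χ u
    ... | yes α⊨u = α , α⊨T , α⊨V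
      where
      α⊨V : ∀ v → v ∈ₛ V → SatParity G χ α v
      α⊨V v v∈V with v ≟ u
      ... | yes refl = α⊨u
      ... | no v≢u   = α⊨V-u v (x∈p∧x≢y⇒x∈p-y v∈V v≢u)
    ... | no α⊭u = flipAt α e , flipAt-preserves-SatTerm T e∉T α⊨T , β⊨V
      where
      β⊨V : ∀ v → v ∈ₛ V → SatParity G χ (flipAt α e) v
      β⊨V v v∈V with v ≟ u
      ... | yes refl = begin
        parityAt G (flipAt α e) u          ≡⟨ parityAt-flipAt α e u ⟩
        parityAt G α u xor incident G u e  ≡⟨ cong (parityAt G α u xor_) incident-u ⟩
        parityAt G α u xor true            ≡⟨ xor-comm _ true ⟩
        not (parityAt G α u)               ≡⟨ ¬-not (≢-sym α⊭u) ⟨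
        χ u                                ∎
        where open ≡-Reasoning
      ... | no v≢u = begin
        parityAt G (flipAt α e) v          ≡⟨ parityAt-flipAt α e v ⟩
        parityAt G α v xor incident G v e  ≡⟨ cong (parityAt G α v xor_) (incident-others v v∈V v≢u) ⟩
        parityAt G α v xor false           ≡⟨ xor-identityʳ _ ⟩
        parityAt G α v                     ≡⟨ α⊨V-u v (x∈p∧x≢y⇒x∈p-y v∈V v≢u) ⟩
        χ v                                ∎
        where open ≡-Reasoning

    leaving-edge-∈-vars : ∀ {V e u} → IsLeast ∣_∣ (UnsatWithParity G χ T) V → LeavesThrough V e u →
      e ∈ map proj₁ T
    leaving-edge-∈-vars {V} {e} {u} (unsat , least) leaves =
      decidable-stable (DecMembership._∈?_ _≟_ e (map proj₁ T)) λ e∉T →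
        ≤⇒≯ (least (V - u) (λ (α , α⊨T , α⊨V-u) → unsat (repair-through leaves e∉T α α⊨T α⊨V-u)))
            (x∈p⇒∣p-x∣<∣p∣ (proj₁ leaves))

    boundarySize-≤-length : ∀ {V} → IsLeast ∣_∣ (UnsatWithParity G χ T) V → boundarySize G V ≤ length T
    boundarySize-≤-length {V} least = subst (boundarySize G V ≤_) (length-map proj₁ T)
      (count-≤-length _ (map proj₁ T) λ e crossing →
        leaving-edge-∈-vars least (proj₂ (crossing-edge-leaves V e crossing)))

  μT-of-unsatisfiable : ∀ {χ t k} → ¬ Σ (Assignment (m G)) (λ α → SatTerm α t) → IsMuT G χ t k → k ≡ 0
  μT-of-unsatisfiable {k = k} t-unsat (_ , least) =
    n≤0⇒n≡0 (subst (k ≤_) (∣⊥∣≡0 (n G)) (least ⊥ λ (α , α⊨t , _) → t-unsat (α , α⊨t)))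

  unsatWithParity-anti-mono : ∀ {χ T′ T V} → T′ ⊆ T → UnsatWithParity G χ T′ V → UnsatWithParity G χ T V
  unsatWithParity-anti-mono T′⊆T unsat (α , α⊨T , α⊨V) = unsat (α , anti-mono T′⊆T α⊨T , α⊨V)

  unsatWithParity-⊤ : ∀ {χ} T → sumOdd χ ≡ true → UnsatWithParity G χ T ⊤
  unsatWithParity-⊤ {χ} T odd (α , _ , α⊨V) = odd-charge-unsatisfiable χ odd α λ v → α⊨V v ∈⊤

  least-unsat-∣V∣≡μ : ∀ {χ 𝐂 t μ α₀ V} → (∀ t′ j → Entails t′ 𝐂 → IsMuT G χ t′ j → j ≤ μ) →
    Entails t 𝐂 → IsMuT G χ t μ → SatTerm α₀ t →
    IsLeast ∣_∣ (UnsatWithParity G χ (hittingSubterm t 𝐂)) V → ∣ V ∣ ≡ μ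
  least-unsat-∣V∣≡μ {𝐂 = 𝐂} {t} {V = V} μ-max t⊨𝐂 (_ , μ-least) α₀⊨t (V-unsat , V-least) =
    ≤-antisym (μ-max (hittingSubterm t 𝐂) ∣ V ∣ (hittingSubterm-entails t 𝐂 α₀⊨t t⊨𝐂)
                     ((V , refl , V-unsat) , V-least))
              (μ-least V (unsatWithParity-anti-mono (hittingSubterm-⊆ t 𝐂) V-unsat))

ℕ→ℚ-mono : ∀ {a b} → a ≤ b → ℕ→ℚ a ≤ℚ ℕ→ℚ b
ℕ→ℚ-mono {a} {b} a≤b = subst₂ _≤ℚ_ (sym (as-mkℚ a)) (sym (as-mkℚ b))
  (*≤* (subst₂ ℤ._≤_ (sym (ℤ.*-identityʳ (ℤ.+ a))) (sym (ℤ.*-identityʳ (ℤ.+ b))) (ℤ.+≤+ a≤b)))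
  where
  as-mkℚ : ∀ k → ℕ→ℚ k ≡ mkℚ (ℤ.+ k) 0 (coprime-sym (1-coprimeTo k))
  as-mkℚ k = ℚ.normalize-coprime (coprime-sym (1-coprimeTo k))

lemma4p9 : (G : Graph) (d : ℕ) (χ : Vtx G → Bool) (s : ℕ) (δ : ℚ) →
    Connected G → Regular G d → sumOdd χ ≡ true → EdgeExpander G s δ →
    (𝐂 : Clauses (m G)) (μ : ℕ) → IsMu G χ 𝐂 μ → μ Data.Nat.≤ s →
    δ *ℚ ℕ→ℚ μ ≤ℚ ℕ→ℚ (length 𝐂)
lemma4p9 G _ χ s δ _ _ odd expander 𝐂 μ (𝐂-unsat⇒μ≡0 , 𝐂-sat⇒μ-attained) μ≤s =
  decidable-stable (δ *ℚ ℕ→ℚ μ ℚ.≤? ℕ→ℚ (length 𝐂)) do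
    yes 𝐂-sat ← ¬¬-excluded-middle
      where no 𝐂-unsat → pure (μ≡0-bound (𝐂-unsat⇒μ≡0 𝐂-unsat))
    let (t , t⊨𝐂 , μT-t) , μ-max = 𝐂-sat⇒μ-attained 𝐂-sat
    yes (α₀ , α₀⊨t) ← ¬¬-excluded-middle {A = Σ (Assignment (m G)) λ α → SatTerm α t}
      where no t-unsat → pure (μ≡0-bound (μT-of-unsatisfiable G t-unsat μT-t))
    let T = hittingSubterm t 𝐂
    (V , V-least) ← least-exists ∣_∣ (UnsatWithParity G χ T) (unsatWithParity-⊤ G T odd)
    let ∣V∣≡μ = least-unsat-∣V∣≡μ G μ-max t⊨𝐂 μT-t α₀⊨t V-least
    pure (begin
      δ *ℚ ℕ→ℚ μ                 ≡⟨ cong (λ k → δ *ℚ ℕ→ℚ k) ∣V∣≡μ ⟨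
      δ *ℚ ℕ→ℚ ∣ V ∣             ≤⟨ expander V (subst (_≤ s) (sym ∣V∣≡μ) μ≤s) ⟩
      ℕ→ℚ (boundarySize G V)     ≤⟨ ℕ→ℚ-mono (boundarySize-≤-length G χ T V-least) ⟩
      ℕ→ℚ (length T)             ≤⟨ ℕ→ℚ-mono (hittingSubterm-length t 𝐂) ⟩
      ℕ→ℚ (length 𝐂)             ∎)
  where
  open ℚ.≤-Reasoning
  μ≡0-bound : μ ≡ 0 → δ *ℚ ℕ→ℚ μ ≤ℚ ℕ→ℚ (length 𝐂)
  μ≡0-bound refl = subst (_≤ℚ ℕ→ℚ (length 𝐂)) (sym (ℚ.*-zeroʳ δ)) (ℕ→ℚ-mono {b = length 𝐂} z≤n)
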